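{- Let $A_1$ and $A_2$ be simple and covering literals that are unifiable with most general unifier $\sigma$. Then $A_1\sigma$ is simple.
   Context: A compound term is a term that is neither a variable nor a constant. $\mathrm{Var}(E)$ is the set of variables of $E$. A literal is simple if every argument is a variable, a constant, or a compound term $f(u_1,\dots,u_n)$ with each $u_i$ a variable or a constant. A literal $L$ is covering if every compound term $t$ in $L$ satisfies $\mathrm{Var}(t)=\mathrm{Var}(L)$. -}

module Defs where

open import Data.Nat using (ℕ)
open import Data.Bool using (Bool)
open import Data.List using (List; []; _∷_)
open import Data.List.Membership.Propositional using (_∈_)
open import Data.List.Relation.Unary.All using (All)
open import Data.Product using (Σ; _×_; ∃)
open import Data.Sum using (_⊎_)
open import Relation.Binary.PropositionalEquality using (_≡_)
open import Function.Bundles using (_⇔_)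

-- A constant is a function symbol applied to no arguments.
-- (Symbols are untyped w.r.t. arity: f applied to lists of different
--  lengths behave as distinct symbols, which is harmless.)
data Term (F : Set) : Set where
  var : ℕ → Term F
  fn  : F → List (Term F) → Term F

module _ {F : Set} where

  Subst : Set
  Subst = ℕ → Term F

  mutual
    _⟨_⟩ : Term F → Subst → Term F
    var x ⟨ σ ⟩ = σ x
    fn f ts ⟨ σ ⟩ = fn f (ts ⟨ σ ⟩*)

    _⟨_⟩* : List (Term F) → Subst → List (Term F)
    [] ⟨ σ ⟩* = []
    (t ∷ ts) ⟨ σ ⟩* = (t ⟨ σ ⟩) ∷ (ts ⟨ σ ⟩*)

  data _⊑_ (t : Term F) : Term F → Set where
    here : t ⊑ t
    sub  : ∀ {f us u} → u ∈ us → t ⊑ u → t ⊑ fn f us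

  IsVar : Term F → Set
  IsVar t = Σ ℕ λ x → t ≡ var x

  IsConst : Term F → Set
  IsConst t = Σ F λ c → t ≡ fn c []

  IsCompound : Term F → Set
  IsCompound (var _) = ⊥'
    where open import Data.Empty renaming (⊥ to ⊥')
  IsCompound (fn _ []) = ⊥'
    where open import Data.Empty renaming (⊥ to ⊥')
  IsCompound (fn _ (_ ∷ _)) = ⊤'
    where open import Data.Unit renaming (⊤ to ⊤')

record Literal (F P : Set) : Set where
  constructor lit
  field
    sign : Bool
    pred : P
    args : List (Term F)

open Literal public

module _ {F P : Set} where

  _⟨_⟩L : Literal F P → Subst {F} → Literal F P
  lit s p ts ⟨ σ ⟩L = lit s p (ts ⟨ σ ⟩*)

  _⊑L_ : Term F → Literal F P → Set
  t ⊑L L = Σ (Term F) λ u → (u ∈ args L) × (t ⊑ u)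

  _∈Var_ : ℕ → Term F → Set
  x ∈Var t = var x ⊑ t

  _∈VarL_ : ℕ → Literal F P → Set
  x ∈VarL L = var x ⊑L L

  VarOrConst : Term F → Set
  VarOrConst t = IsVar t ⊎ IsConst t

  SimpleArg : Term F → Set
  SimpleArg (var x) = ⊤'
    where open import Data.Unit renaming (⊤ to ⊤')
  SimpleArg (fn f us) = All VarOrConst us

  IsSimple : Literal F P → Set
  IsSimple L = All SimpleArg (args L)

  IsCovering : Literal F P → Set
  IsCovering L = ∀ t → t ⊑L L → IsCompound t → ∀ x → (x ∈Var t ⇔ x ∈VarL L)

  IsUnifier : Subst {F} → Literal F P → Literal F P → Set
  IsUnifier σ L₁ L₂ = L₁ ⟨ σ ⟩L ≡ L₂ ⟨ σ ⟩L

  Unifiable : Literal F P → Literal F P → Set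
  Unifiable L₁ L₂ = Σ (Subst {F}) λ θ → IsUnifier θ L₁ L₂

  IsMGU : Subst {F} → Literal F P → Literal F P → Set
  IsMGU σ L₁ L₂ = IsUnifier σ L₁ L₂ ×
    (∀ θ → IsUnifier θ L₁ L₂ → Σ (Subst {F}) λ δ → ∀ x → θ x ≡ (σ x) ⟨ δ ⟩)

module Submission where

-- Call a variable of one literal "clashing" if it stands, as a whole argument, opposite a
-- compound argument of the other literal.  Covering forces every variable of that other
-- literal to occur in the compound, so under σ it is mapped strictly below the clashing
-- variable.  Hence clashes cannot occur in both directions at once.
--
-- The core is the case where no variable of B clashes with a compound of A.  From σ we build
-- the shallow unifier θ = ψ ∘ σ, except that variables of A clashing with compounds of B get
-- φ ∘ σ, where ψ collapses compound terms to a variable and φ keeps only the head symbol.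
-- Since σ is most general, θ = δ ∘ σ for some δ; a substitution never turns a compound term
-- into a variable or constant, so σ maps every variable of B to a variable or constant.
-- Then Bσ is simple, and so is Aσ = Bσ.  The theorem follows by applying this with
-- (A, B) = (A₁, A₂) or (A₂, A₁), whichever has no clash from B into A.

open import Defs
open import Data.Nat using (ℕ; suc; _+_; _≤_; _<_; s≤s)
open import Data.Nat.Properties using (≤-refl; ≤-trans; m≤m+n; m≤n+m; n≤1+n; <-irrefl; <-asym; _≟_)
open import Data.List using (List; []; _∷_; map)
open import Data.List.Properties using (∷-injective)
open import Data.List.Membership.Propositional using (_∈_)
open import Data.List.Relation.Unary.Any using (here; there)
open import Data.List.Relation.Unary.All using (All; []; _∷_; lookup)
open import Data.Product using (Σ; _×_; _,_; proj₁; proj₂)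
open import Data.Sum using (inj₁; inj₂)
open import Data.Unit using (tt)
open import Data.Empty using (⊥; ⊥-elim)
open import Relation.Nullary using (Dec; yes; no; ¬_; contradiction)
open import Relation.Nullary.Decidable using (map′; _×-dec_)
open import Relation.Binary.PropositionalEquality using (_≡_; refl; sym; trans; cong; cong₂; subst; module ≡-Reasoning)
open import Function.Bundles using (Equivalence)

module _ {F : Set} where

  mutual
    size : Term F → ℕ
    size (var _) = 0
    size (fn _ ts) = suc (sizes ts)

    sizes : List (Term F) → ℕ
    sizes [] = 0
    sizes (t ∷ ts) = size t + sizes ts

  ∈-sizes : ∀ {u us} → u ∈ us → size u ≤ sizes us
  ∈-sizes {u} {_ ∷ us} (here refl) = m≤m+n (size u) (sizes us)
  ∈-sizes {u} {v ∷ us} (there m) = ≤-trans (∈-sizes m) (m≤n+m (sizes us) (size v))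

  ⊑-size : ∀ {t u} → t ⊑ u → size t ≤ size u
  ⊑-size here = ≤-refl
  ⊑-size (sub m p) = ≤-trans (⊑-size p) (≤-trans (∈-sizes m) (n≤1+n _))

  proper-subterm-smaller : ∀ {t u f us} → u ∈ us → t ⊑ u → size t < size (fn f us)
  proper-subterm-smaller m p = s≤s (≤-trans (⊑-size p) (∈-sizes m))

  ∈-subst : ∀ {u us} (σ : Subst {F}) → u ∈ us → (u ⟨ σ ⟩) ∈ (us ⟨ σ ⟩*)
  ∈-subst σ (here refl) = here refl
  ∈-subst σ (there m) = there (∈-subst σ m)

  ⊑-subst : ∀ {t u} (σ : Subst {F}) → t ⊑ u → (t ⟨ σ ⟩) ⊑ (u ⟨ σ ⟩)
  ⊑-subst σ here = here
  ⊑-subst σ (sub m p) = sub (∈-subst σ m) (⊑-subst σ p)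

  -- The image of a variable occurring in a non-variable term is strictly smaller than the
  -- image of that term: this is the occurs check.
  occurs-smaller : ∀ {x f us} (σ : Subst {F}) → var x ⊑ fn f us → size (σ x) < size (fn f us ⟨ σ ⟩)
  occurs-smaller {f = f} σ (sub m p) = proper-subterm-smaller {f = f} (∈-subst σ m) (⊑-subst σ p)

  fn-injective : ∀ {f g : F} {us vs} → fn f us ≡ fn g vs → f ≡ g × us ≡ vs
  fn-injective refl = refl , refl

  data Opposite : List (Term F) → List (Term F) → Term F → Term F → Set where
    first : ∀ {s t ss ts} → Opposite (s ∷ ss) (t ∷ ts) s t
    next  : ∀ {s t s′ t′ ss ts} → Opposite ss ts s t → Opposite (s′ ∷ ss) (t′ ∷ ts) s t

  opposite-∈ˡ : ∀ {ss ts s t} → Opposite ss ts s t → s ∈ ss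
  opposite-∈ˡ first = here refl
  opposite-∈ˡ (next p) = there (opposite-∈ˡ p)

  opposite-∈ʳ : ∀ {ss ts s t} → Opposite ss ts s t → t ∈ ts
  opposite-∈ʳ first = here refl
  opposite-∈ʳ (next p) = there (opposite-∈ʳ p)

  opposite-swap : ∀ {ss ts s t} → Opposite ss ts s t → Opposite ts ss t s
  opposite-swap first = first
  opposite-swap (next p) = next (opposite-swap p)

  opposite-unified : ∀ {ss ts s t} (σ : Subst {F}) →
    ss ⟨ σ ⟩* ≡ ts ⟨ σ ⟩* → Opposite ss ts s t → s ⟨ σ ⟩ ≡ t ⟨ σ ⟩
  opposite-unified σ e first = proj₁ (∷-injective e)
  opposite-unified σ e (next p) = opposite-unified σ (proj₂ (∷-injective e)) p

  unify-positionwise : ∀ (σ θ : Subst {F}) ss ts →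
    (∀ {s t} → Opposite ss ts s t → s ⟨ σ ⟩ ≡ t ⟨ σ ⟩ → s ⟨ θ ⟩ ≡ t ⟨ θ ⟩) →
    ss ⟨ σ ⟩* ≡ ts ⟨ σ ⟩* → ss ⟨ θ ⟩* ≡ ts ⟨ θ ⟩*
  unify-positionwise σ θ [] [] k e = refl
  unify-positionwise σ θ (s ∷ ss) (t ∷ ts) k e =
    cong₂ _∷_ (k first (proj₁ (∷-injective e)))
              (unify-positionwise σ θ ss ts (λ p → k (next p)) (proj₂ (∷-injective e)))

  Somewhere : (Term F → Term F → Set) → List (Term F) → List (Term F) → Set
  Somewhere R ss ts = Σ (Term F) λ s → Σ (Term F) λ t → Opposite ss ts s t × R s t

  somewhere? : ∀ {R} → (∀ s t → Dec (R s t)) → ∀ ss ts → Dec (Somewhere R ss ts)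
  somewhere? R? [] ts = no λ { (_ , _ , () , _) }
  somewhere? R? (s ∷ ss) [] = no λ { (_ , _ , () , _) }
  somewhere? {R} R? (s ∷ ss) (t ∷ ts) with R? s t
  ... | yes r = yes (s , t , first , r)
  ... | no ¬r = map′ (λ { (s′ , t′ , p , r) → s′ , t′ , next p , r }) drop-first (somewhere? R? ss ts)
    where
    drop-first : Somewhere R (s ∷ ss) (t ∷ ts) → Somewhere R ss ts
    drop-first (_ , _ , first , r) = contradiction r ¬r
    drop-first (s′ , t′ , next p , r) = s′ , t′ , p , r

  is-var? : ∀ (s : Term F) → Dec (IsVar s)
  is-var? (var x) = yes (x , refl)
  is-var? (fn f ts) = no λ { (_ , ()) }

  is-var-of? : ∀ x (s : Term F) → Dec (s ≡ var x)
  is-var-of? x (var y) = map′ (cong var) (λ { refl → refl }) (y ≟ x)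
  is-var-of? x (fn f ts) = no λ ()

  is-compound? : ∀ (t : Term F) → Dec (IsCompound t)
  is-compound? (var x) = no λ ()
  is-compound? (fn f []) = no λ ()
  is-compound? (fn f (_ ∷ _)) = yes tt

  Clashes : ℕ → List (Term F) → List (Term F) → Set
  Clashes x = Somewhere λ s t → s ≡ var x × IsCompound t

  clashes? : ∀ x ss ts → Dec (Clashes x ss ts)
  clashes? x = somewhere? λ s t → is-var-of? x s ×-dec is-compound? t

  SomeClash : List (Term F) → List (Term F) → Set
  SomeClash = Somewhere λ s t → IsVar s × IsCompound t

  some-clash? : ∀ ss ts → Dec (SomeClash ss ts)
  some-clash? = somewhere? λ s t → is-var? s ×-dec is-compound? t

  ψ : Term F → Term F
  ψ (var x) = var x
  ψ (fn f []) = fn f []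
  ψ (fn f (_ ∷ _)) = var 0

  φ : Term F → Term F
  φ (var x) = var x
  φ (fn f ts) = fn f (map ψ ts)

module _ {F P : Set} where

  -- VarOrConst and SimpleArg carry an unused literal-signature parameter; fix it to P.
  VC : Term F → Set
  VC = VarOrConst {F} {P}

  SA : Term F → Set
  SA = SimpleArg {F} {P}

  ψ-VC : ∀ t → VC (ψ t)
  ψ-VC (var x) = inj₁ (x , refl)
  ψ-VC (fn f []) = inj₂ (f , refl)
  ψ-VC (fn f (_ ∷ _)) = inj₁ (0 , refl)

  VC⇒SA : ∀ t → VC t → SA t
  VC⇒SA .(var x) (inj₁ (x , refl)) = tt
  VC⇒SA .(fn c []) (inj₂ (c , refl)) = []

  VC-pullback : ∀ t (δ : Subst {F}) → VC (t ⟨ δ ⟩) → VC t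
  VC-pullback (var x) δ _ = inj₁ (x , refl)
  VC-pullback (fn f []) δ _ = inj₂ (f , refl)
  VC-pullback (fn f (_ ∷ _)) δ (inj₁ (_ , ()))
  VC-pullback (fn f (_ ∷ _)) δ (inj₂ (_ , ()))

  all-subst : ∀ {Q R : Term F → Set} (σ : Subst {F}) us →
    (∀ {u} → u ∈ us → Q u → R (u ⟨ σ ⟩)) → All Q us → All R (us ⟨ σ ⟩*)
  all-subst σ [] k [] = []
  all-subst σ (u ∷ us) k (q ∷ qs) = k (here refl) q ∷ all-subst σ us (λ m → k (there m)) qs

  SA-subst : ∀ (σ : Subst {F}) t → SA t → (∀ x → var x ⊑ t → VC (σ x)) → SA (t ⟨ σ ⟩)
  SA-subst σ (var x) _ vc = VC⇒SA (σ x) (vc x here)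
  SA-subst σ (fn f us) sa vc = all-subst σ us subst-VC sa
    where
    subst-VC : ∀ {u} → u ∈ us → VC u → VC (u ⟨ σ ⟩)
    subst-VC m (inj₁ (z , refl)) = vc z (sub m here)
    subst-VC m (inj₂ (c , refl)) = inj₂ (c , refl)

  simple-subst : ∀ (σ : Subst {F}) (L : Literal F P) →
    IsSimple L → (∀ x → x ∈VarL L → VC (σ x)) → IsSimple (L ⟨ σ ⟩L)
  simple-subst σ (lit s p ts) simple vc =
    all-subst σ ts (λ {u} m sa → SA-subst σ u sa (λ x x⊑u → vc x (u , m , x⊑u))) simple

  -- Under a unifier of ss with the arguments of a covering literal B, a variable of ss
  -- clashing with a compound argument t of B dominates every variable w of B, since w
  -- occurs in t.
  clash-dominates : ∀ (σ : Subst {F}) ss (B : Literal F P) {x w} → IsCovering B →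
    ss ⟨ σ ⟩* ≡ args B ⟨ σ ⟩* → Clashes x ss (args B) → w ∈VarL B → size (σ w) < size (σ x)
  clash-dominates σ ss B covering e (.(var _) , fn g (a ∷ as) , opp , refl , _) w∈B =
    subst (λ u → size (σ _) < size u) (sym (opposite-unified σ e opp))
      (occurs-smaller σ (Equivalence.from (covering _ (_ , opposite-∈ʳ opp , here) tt _) w∈B))

  no-mutual-clash : ∀ (σ : Subst {F}) (A B : Literal F P) → IsCovering A → IsCovering B →
    IsUnifier σ A B → SomeClash (args A) (args B) → SomeClash (args B) (args A) → ⊥
  no-mutual-clash σ A B coveringA coveringB u
    (_ , s , oAB , (x , refl) , compound-s) (_ , t , oBA , (y , refl) , compound-t) =
    <-asym (clash-dominates σ (args A) B coveringB e (_ , s , oAB , refl , compound-s) y∈B)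
           (clash-dominates σ (args B) A coveringA (sym e) (_ , t , oBA , refl , compound-t) x∈A)
    where
    e : args A ⟨ σ ⟩* ≡ args B ⟨ σ ⟩*
    e = cong args u
    x∈A : x ∈VarL A
    x∈A = var x , opposite-∈ˡ oAB , here
    y∈B : y ∈VarL B
    y∈B = var y , opposite-∈ˡ oBA , here

  unifier-from-args : ∀ (σ θ : Subst {F}) (A B : Literal F P) → IsUnifier σ A B →
    args A ⟨ θ ⟩* ≡ args B ⟨ θ ⟩* → IsUnifier θ A B
  unifier-from-args σ θ (lit s p ss) (lit s′ p′ ts) u e with cong sign u | cong pred u
  ... | refl | refl = cong (lit s p) e

  mgu-sym : ∀ {σ : Subst {F}} {A B : Literal F P} → IsMGU σ A B → IsMGU σ B A
  mgu-sym (u , general) = sym u , λ θ u′ → general θ (sym u′)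

module Shallow {F P : Set} (σ : Subst {F}) (A B : Literal F P) (mgu : IsMGU σ A B)
  (simpleA : IsSimple A) (simpleB : IsSimple B) (coveringB : IsCovering B)
  (no-clash : ¬ SomeClash (args B) (args A)) where

  unifies : args A ⟨ σ ⟩* ≡ args B ⟨ σ ⟩*
  unifies = cong args (proj₁ mgu)

  ClashesIntoB : ℕ → Set
  ClashesIntoB v = Clashes v (args A) (args B)

  not-clashing : ∀ {z w} → σ z ≡ σ w → w ∈VarL B → ¬ ClashesIntoB z
  not-clashing e w∈B c = <-irrefl (cong size (sym e)) (clash-dominates σ (args A) B coveringB unifies c w∈B)

  θ : Subst {F}
  θ v with clashes? v (args A) (args B)
  ... | yes _ = φ (σ v)
  ... | no _ = ψ (σ v)

  θ-clashing : ∀ {v} → ClashesIntoB v → θ v ≡ φ (σ v)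
  θ-clashing {v} c with clashes? v (args A) (args B)
  ... | yes _ = refl
  ... | no ¬c = contradiction c ¬c

  θ-not-clashing : ∀ {v} → ¬ ClashesIntoB v → θ v ≡ ψ (σ v)
  θ-not-clashing {v} ¬c with clashes? v (args A) (args B)
  ... | yes c = contradiction c ¬c
  ... | no _ = refl

  θ-const : ∀ {v c} → σ v ≡ fn c [] → θ v ≡ fn c []
  θ-const {v} e with clashes? v (args A) (args B)
  ... | yes _ rewrite e = refl
  ... | no _ rewrite e = refl

  θ-var-B : ∀ {w} → w ∈VarL B → θ w ≡ ψ (σ w)
  θ-var-B w∈B = θ-not-clashing (not-clashing refl w∈B)

  θ-vars : ∀ {z w} → σ z ≡ σ w → w ∈VarL B → θ z ≡ θ w
  θ-vars e w∈B = trans (θ-not-clashing (not-clashing e w∈B)) (trans (cong ψ e) (sym (θ-var-B w∈B)))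

  θ-atom-B : ∀ {v} → VC {F} {P} v → (∀ {w} → v ≡ var w → w ∈VarL B) → v ⟨ θ ⟩ ≡ ψ (v ⟨ σ ⟩)
  θ-atom-B (inj₁ (w , refl)) inB = θ-var-B (inB refl)
  θ-atom-B (inj₂ (c , refl)) inB = refl

  map-ψ-σ : ∀ vs → (∀ {v} → v ∈ vs → v ⟨ θ ⟩ ≡ ψ (v ⟨ σ ⟩)) → map ψ (vs ⟨ σ ⟩*) ≡ vs ⟨ θ ⟩*
  map-ψ-σ [] agree = refl
  map-ψ-σ (v ∷ vs) agree = cong₂ _∷_ (sym (agree (here refl))) (map-ψ-σ vs (λ m → agree (there m)))

  θ-atoms : ∀ {u v} → VC {F} {P} u → VC {F} {P} v → (∀ {w} → v ≡ var w → w ∈VarL B) →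
    u ⟨ σ ⟩ ≡ v ⟨ σ ⟩ → u ⟨ θ ⟩ ≡ v ⟨ θ ⟩
  θ-atoms (inj₁ (z , refl)) (inj₁ (w , refl)) inB e = θ-vars e (inB refl)
  θ-atoms (inj₁ (z , refl)) (inj₂ (c , refl)) inB e = θ-const e
  θ-atoms (inj₂ (c , refl)) (inj₁ (w , refl)) inB e = sym (θ-const (sym e))
  θ-atoms (inj₂ (c , refl)) (inj₂ (d , refl)) inB e = e

  θ-unifies-opposite : ∀ {s t} → Opposite (args A) (args B) s t → s ⟨ σ ⟩ ≡ t ⟨ σ ⟩ → s ⟨ θ ⟩ ≡ t ⟨ θ ⟩
  θ-unifies-opposite {var x} {var y} o e = θ-vars e (var y , opposite-∈ʳ o , here)
  θ-unifies-opposite {var x} {fn g []} o e = θ-const e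
  θ-unifies-opposite {var x} {fn g (a ∷ as)} o e = begin
      θ x                              ≡⟨ θ-clashing (var x , _ , o , refl , tt) ⟩
      φ (σ x)                          ≡⟨ cong φ e ⟩
      fn g (map ψ ((a ∷ as) ⟨ σ ⟩*))   ≡⟨ cong (fn g) (map-ψ-σ (a ∷ as) atom) ⟩
      fn g ((a ∷ as) ⟨ θ ⟩*)           ∎
    where
    open ≡-Reasoning
    atom : ∀ {v} → v ∈ a ∷ as → v ⟨ θ ⟩ ≡ ψ (v ⟨ σ ⟩)
    atom m = θ-atom-B (lookup (lookup simpleB (opposite-∈ʳ o)) m)
                      (λ { refl → fn g (a ∷ as) , opposite-∈ʳ o , sub m here })
  θ-unifies-opposite {fn f []} {var y} o e = sym (θ-const (sym e))
  θ-unifies-opposite {fn f []} {fn g []} o e = e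
  θ-unifies-opposite {fn f []} {fn g (_ ∷ _)} o ()
  θ-unifies-opposite {fn f (_ ∷ _)} {var y} o e =
    contradiction (var y , _ , opposite-swap o , (y , refl) , tt) no-clash
  θ-unifies-opposite {fn f (_ ∷ _)} {fn g []} o ()
  θ-unifies-opposite {fn f (b ∷ bs)} {fn g (a ∷ as)} o e with fn-injective e
  ... | refl , e′ = cong (fn f) (unify-positionwise σ θ (b ∷ bs) (a ∷ as) inner e′)
    where
    inner : ∀ {u v} → Opposite (b ∷ bs) (a ∷ as) u v → u ⟨ σ ⟩ ≡ v ⟨ σ ⟩ → u ⟨ θ ⟩ ≡ v ⟨ θ ⟩
    inner o′ = θ-atoms (lookup (lookup simpleA (opposite-∈ˡ o)) (opposite-∈ˡ o′))
                       (lookup (lookup simpleB (opposite-∈ʳ o)) (opposite-∈ʳ o′))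
                       (λ { refl → fn g (a ∷ as) , opposite-∈ʳ o , sub (opposite-∈ʳ o′) here })

  θ-unifies : IsUnifier θ A B
  θ-unifies = unifier-from-args σ θ A B (proj₁ mgu)
    (unify-positionwise σ θ (args A) (args B) θ-unifies-opposite unifies)

  -- θ factors through the most general σ, and θ sends variables of B to variables or
  -- constants; pulling back along the factor shows σ does too.
  B-vars-atomic : ∀ w → w ∈VarL B → VC {F} {P} (σ w)
  B-vars-atomic w w∈B with proj₂ mgu θ θ-unifies
  ... | δ , factor = VC-pullback {P = P} (σ w) δ (subst (VC {F} {P}) (trans (sym (θ-var-B w∈B)) (factor w)) (ψ-VC {P = P} (σ w)))

  simple-B : IsSimple (B ⟨ σ ⟩L)
  simple-B = simple-subst σ B simpleB B-vars-atomic

  simple-A : IsSimple (A ⟨ σ ⟩L)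
  simple-A = subst IsSimple (sym (proj₁ mgu)) simple-B

mainTheorem8 : {F P : Set} (A₁ A₂ : Literal F P) (σ : Subst {F}) →
    IsSimple A₁ → IsCovering A₁ → IsSimple A₂ → IsCovering A₂ →
    Unifiable A₁ A₂ → IsMGU σ A₁ A₂ →
    IsSimple (A₁ ⟨ σ ⟩L)
mainTheorem8 A₁ A₂ σ simple₁ covering₁ simple₂ covering₂ _ mgu
  with some-clash? (args A₂) (args A₁) | some-clash? (args A₁) (args A₂)
... | no c₂₁ | _ = Shallow.simple-A σ A₁ A₂ mgu simple₁ simple₂ covering₂ c₂₁
... | yes _ | no c₁₂ = Shallow.simple-B σ A₂ A₁ (mgu-sym mgu) simple₂ simple₁ covering₁ c₁₂
... | yes c₂₁ | yes c₁₂ = ⊥-elim (no-mutual-clash σ A₁ A₂ covering₁ covering₂ (proj₁ mgu) c₁₂ c₂₁)
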